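{- Let $k\ge 1$ and $n\ge 1$ be integers, let $T$ be a $(k+1)$-ary increasing tree of size $n$, and let $\sigma=\sigma_1\cdots\sigma_{kn}$ be the $k$-Stirling permutation of size $n$ obtained from $T$ by the depth-first-walk coding described in the context. Then for every $i$ with $1\le i\le n$, the local type of $i$ in $\sigma$ equals the node type of the node labelled $i$ in $T$, i.e. $L_i(\sigma)=G_i(T)$.
   Context: A $k$-Stirling permutation of size $n$ is a permutation (word) of the multiset $\{1^k,2^k,\dots,n^k\}$ such that for each $i$, all entries occurring between two occurrences of $i$ are at least $i$. A $(k+1)$-ary increasing tree of size $n$ is a rooted tree on the node set $\{1,\dots,n\}$ in which each node has $k+1$ distinguishable child positions (ordered left to right), each either occupied by a child node or vacant (a vacant position is called an external node), and labels increase along every path from the root (so the root is $1$). Coding: in each internal node $v$, between its $k+1$ consecutive outgoing positions place $k$ copies of the label $v$; perform the depth-first (contour) walk starting at the root, visiting the child positions left to right, and record a label $v$ each of the $k$ times the walk returns to $v$ between two consecutive child positions (not on first arrival and not on final departure); external nodes contribute nothing. The resulting word of length $kn$ is a $k$-Stirling permutation, and this coding is a bijection. Node type: $G_i(T)=g_{i,1}\cdots g_{i,k+1}\in\{0,1\}^{k+1}$, where $g_{i,h}=1$ if the $h$-th child position (from the left) of node $i$ is occupied by a node and $g_{i,h}=0$ otherwise. Local type: for a $k$-Stirling permutation $\sigma=\sigma_1\cdots\sigma_{kn}$ use boundary conventions $\sigma_0=\sigma_{kn+1}=-\infty$, and let $j_{i,1}<\dots<j_{i,k}$ be the positions with $\sigma_{j_{i,h}}=i$.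 Then $L_i(\sigma)=\ell_{i,1}\cdots\ell_{i,k+1}\in\{0,1\}^{k+1}$ where $\ell_{i,1}=0$ if $\sigma_{j_{i,1}-1}<\sigma_{j_{i,1}}$ and $\ell_{i,1}=1$ if $\sigma_{j_{i,1}-1}>\sigma_{j_{i,1}}$; $\ell_{i,k+1}=0$ if $\sigma_{j_{i,k}}>\sigma_{j_{i,k}+1}$ and $\ell_{i,k+1}=1$ if $\sigma_{j_{i,k}}<\sigma_{j_{i,k}+1}$; and for $2\le h\le k$, $\ell_{i,h}=0$ if $\sigma_{j_{i,h}-1}=\sigma_{j_{i,h}}$ and $\ell_{i,h}=1$ otherwise. -}

module Defs where

open import Data.Nat using (ℕ; zero; suc; _∸_; _<_; _≤_)
open import Data.Bool using (Bool; true; false)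
open import Data.Maybe using (Maybe; just; nothing)
open import Data.Fin using (Fin; toℕ; inject₁) renaming (suc to fsuc)
open import Data.List using (List; []; _∷_; _++_; length; map; upTo)
open import Data.Vec using (Vec; []; _∷_; lookup)
import Data.Vec as Vec
open import Data.Vec.Relation.Unary.All using (All)
open import Data.Vec.Relation.Unary.Any using (Any)
open import Data.List.Relation.Binary.Permutation.Propositional using (_↭_)
open import Data.Product using (Σ; _×_; ∃)
open import Data.Sum using (_⊎_)
open import Data.Unit using (⊤)
open import Relation.Binary.PropositionalEquality using (_≡_; _≢_)

-- (k+1)-ary trees: each internal node carries a label and has exactly
-- k+1 ordered child positions; a vacant position is an external node.

data Tree (k : ℕ) : Set where
  ext  : Tree k
  node : ℕ → Vec (Tree k) (suc k) → Tree k

mutual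
  labels : ∀ {k} → Tree k → List ℕ
  labels ext         = []
  labels (node v cs) = v ∷ labelsVec cs

  labelsVec : ∀ {k m} → Vec (Tree k) m → List ℕ
  labelsVec []       = []
  labelsVec (c ∷ cs) = labels c ++ labelsVec cs

Above : ∀ {k} → ℕ → Tree k → Set
Above v ext        = ⊤
Above v (node w _) = v < w

data Increasing {k : ℕ} : Tree k → Set where
  ext  : Increasing ext
  node : ∀ {v cs} → All Increasing cs → All (Above v) cs → Increasing (node v cs)

IsIncreasingTree : (k n : ℕ) → Tree k → Set
IsIncreasingTree k n T = Increasing T × (labels T ↭ map suc (upTo n))

-- Depth-first-walk coding: at node v with children c₁ … c_{k+1} the walk
-- produces  code(c₁) v code(c₂) v … v code(c_{k+1}).

mutual
  code : ∀ {k} → Tree k → List ℕ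
  code ext              = []
  code (node v (c ∷ cs)) = code c ++ codeRest v cs

  codeRest : ∀ {k m} → ℕ → Vec (Tree k) m → List ℕ
  codeRest v []       = []
  codeRest v (c ∷ cs) = v ∷ (code c ++ codeRest v cs)

data HasNode {k : ℕ} : Tree k → ℕ → Vec (Tree k) (suc k) → Set where
  here  : ∀ {v cs} → HasNode (node v cs) v cs
  there : ∀ {v cs i ds} → Any (λ c → HasNode c i ds) cs → HasNode (node v cs) i ds

occupied : ∀ {k} → Tree k → Bool
occupied ext        = false
occupied (node _ _) = true

-- G_i(T) for the node whose children are cs (true = 1, false = 0)
nodeTypeOf : ∀ {k} → Vec (Tree k) (suc k) → Vec Bool (suc k)
nodeTypeOf cs = Vec.map occupied cs

-- entries extended by -∞ (nothing) : σ_0 = σ_{len+1} = -∞ ; 1-based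
val : List ℕ → ℕ → Maybe ℕ
val σ        zero          = nothing
val []       (suc j)       = nothing
val (x ∷ σ)  (suc zero)    = just x
val (x ∷ σ)  (suc (suc j)) = val σ (suc j)

data _<ᵉ_ : Maybe ℕ → Maybe ℕ → Set where
  -∞<just  : ∀ {a} → nothing <ᵉ just a
  just<just : ∀ {a b} → a < b → just a <ᵉ just b

IsPositions : ∀ {k} → List ℕ → ℕ → Vec ℕ k → Set
IsPositions {k} σ i js =
  (∀ (h : Fin k) → val σ (lookup js h) ≡ just i) ×
  (∀ (h h′ : Fin k) → toℕ h < toℕ h′ → lookup js h < lookup js h′) ×
  (∀ (j : ℕ) → val σ j ≡ just i → ∃ λ (h : Fin k) → lookup js h ≡ j)

LeftCond : List ℕ → ℕ → Bool → Set
LeftCond σ j b =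
  (val σ (j ∸ 1) <ᵉ val σ j × b ≡ false) ⊎ (val σ j <ᵉ val σ (j ∸ 1) × b ≡ true)

RightCond : List ℕ → ℕ → Bool → Set
RightCond σ j b =
  (val σ (suc j) <ᵉ val σ j × b ≡ false) ⊎ (val σ j <ᵉ val σ (suc j) × b ≡ true)

MidCond : List ℕ → ℕ → Bool → Set
MidCond σ j b =
  (val σ (j ∸ 1) ≡ val σ j × b ≡ false) ⊎ (val σ (j ∸ 1) ≢ val σ j × b ≡ true)

-- With occurrence index h (0-based,
-- h = 0 … k-1) at position j = js[h]:
--   h = 0      determines ℓ[0]   (= ℓ_{i,1}),
--   h ≥ 1      determines ℓ[h]   (= ℓ_{i,h+1}, middle entries),
--   h = k-1    determines ℓ[k]   (= ℓ_{i,k+1}).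
LocalType : (k : ℕ) → List ℕ → ℕ → Vec Bool (suc k) → Set
LocalType k σ i ℓ =
  Σ (Vec ℕ k) λ js → IsPositions σ i js ×
    (∀ (h : Fin k) →
       (toℕ h ≡ 0 → LeftCond σ (lookup js h) (lookup ℓ (inject₁ h))) ×
       (toℕ h ≢ 0 → MidCond σ (lookup js h) (lookup ℓ (inject₁ h))) ×
       (suc (toℕ h) ≡ k → RightCond σ (lookup js h) (lookup ℓ (fsuc h))))

module Submission where

-- The proof separates a statement about words from a statement about trees.
--
-- A "block word" for the letter i is  B₀ i B₁ i … i B_k  where every
-- entry of every block Bₕ is larger than i.  If such a word sits inside
-- σ = P ++ B₀ i B₁ … i B_k ++ S, where P and S avoid i, the last entry of P
-- and the first entry of S are below i (or absent, i.e. -∞), then the k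
-- separating copies of i are exactly the occurrences of i in σ, and the
-- neighbour of each copy is either the next entry beyond an empty block or an
-- entry of a non-empty block, hence above i.  So the local type of i in σ
-- records which blocks are non-empty (blockWord-localType).
--
-- The code of a node v with children c₀ … c_k is the block word
-- code c₀ v code c₁ … v code c_k.  In an increasing tree with distinct labels,
-- the code of the subtree at i occurs in code T between contexts of the above
-- kind (embedded), the codes of the children of i have entries above i, and a
-- child is an internal node exactly when its code is non-empty.

open import Defs
open import Data.Nat using (ℕ; zero; suc; pred; _+_; _∸_; _≤_; _<_; z≤n; s≤s)
open import Data.Nat.Properties
  using (+-assoc; +-suc; +-identityʳ; suc-injective; <-trans; <-irrefl; <⇒≢; ≤-refl; <-≤-trans; ≤-reflexive)
open import Data.Bool using (Bool; true; false)
open import Data.Maybe using (Maybe; just)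
open import Data.Maybe.Properties using (just-injective)
open import Data.Fin using (Fin; toℕ; inject₁) renaming (zero to fzero; suc to fsuc)
open import Data.List using (List; []; _∷_; _++_; length; _∷ʳ_; map; upTo)
open import Data.List.Properties using (++-assoc; ++-identityʳ; length-++)
open import Data.List.Relation.Unary.All as All using (All; []; _∷_)
import Data.List.Relation.Unary.All.Properties as All
open import Data.List.Relation.Unary.Any using (here; there)
open import Data.List.Membership.Propositional using (_∈_)
open import Data.List.Membership.Propositional.Properties using (∈-++⁺ˡ; ∈-++⁺ʳ)
open import Data.List.Relation.Unary.Unique.Propositional using (Unique)
import Data.List.Relation.Unary.Unique.Propositional.Properties as Unique
open import Data.List.Relation.Unary.AllPairs using ([]; _∷_)
open import Data.List.Relation.Binary.Disjoint.Propositional using (Disjoint)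
import Data.List.Relation.Binary.Disjoint.Propositional.Properties as DisjointProps
open import Data.List.Relation.Binary.Permutation.Propositional using (_↭_; ↭-sym; ↭⇒↭ₛ)
open import Data.List.Relation.Binary.Permutation.Setoid.Properties using (AllPairs-resp-↭)
open import Data.Vec using (Vec; []; _∷_; lookup)
import Data.Vec as Vec
import Data.Vec.Properties as Vec
import Data.Vec.Relation.Unary.All as VAll
open import Data.Vec.Relation.Unary.All.Properties using (lookup⁺)
open import Data.Vec.Relation.Unary.Any using (here; there)
import Data.Vec.Relation.Unary.Any as VAny
open import Data.Product using (_×_; ∃; ∃₂; _,_; proj₁; proj₂)
open import Data.Sum using (_⊎_; inj₁; inj₂)
open import Data.Empty using (⊥-elim)
open import Function using (_∘_)
open import Relation.Binary.PropositionalEquality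
  using (_≡_; _≢_; refl; sym; trans; cong; subst; subst₂; ≢-sym; setoid; module ≡-Reasoning)
open import Relation.Binary.Properties.Setoid using (≉-resp₂)

-- Entries of a word next to its ends: -∞ (nothing) for the empty word.

lastᵉ : List ℕ → Maybe ℕ
lastᵉ σ = val σ (length σ)

headᵉ : List ℕ → Maybe ℕ
headᵉ σ = val σ 1

val-∈ : ∀ σ j {x} → val σ j ≡ just x → x ∈ σ
val-∈ σ        zero          ()
val-∈ []       (suc j)       ()
val-∈ (y ∷ σ)  (suc zero)    refl = here refl
val-∈ (y ∷ σ)  (suc (suc j)) e    = there (val-∈ σ (suc j) e)

val-++ˡ : ∀ X Y j → j ≤ length X → val (X ++ Y) j ≡ val X j
val-++ˡ X       Y zero          _       = refl
val-++ˡ (x ∷ X) Y (suc zero)    _       = refl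
val-++ˡ (x ∷ X) Y (suc (suc j)) (s≤s p) = val-++ˡ X Y (suc j) p

val-++-split : ∀ X Y j {x} → val (X ++ Y) j ≡ just x →
  x ∈ X ⊎ ∃ λ m → j ≡ suc (length X + m) × val Y (suc m) ≡ just x
val-++-split X       Y zero          ()
val-++-split []      Y (suc m)       e    = inj₂ (m , refl , e)
val-++-split (y ∷ X) Y (suc zero)    refl = inj₁ (here refl)
val-++-split (y ∷ X) Y (suc (suc j)) e with val-++-split X Y (suc j) e
... | inj₁ x∈X            = inj₁ (there x∈X)
... | inj₂ (m , refl , e′) = inj₂ (m , refl , e′)

val-at : ∀ X {x R} → val (X ++ x ∷ R) (suc (length X)) ≡ just x
val-at []      = refl
val-at (y ∷ X) = val-at X

val-after : ∀ X {x R} → val (X ++ x ∷ R) (suc (suc (length X))) ≡ headᵉ R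
val-after []      = refl
val-after (y ∷ X) = val-after X

neighbours : ∀ {σ X x R j} → σ ≡ X ++ x ∷ R → j ≡ suc (length X) →
  val σ j ≡ just x × val σ (j ∸ 1) ≡ lastᵉ X × val σ (suc j) ≡ headᵉ R
neighbours {X = X} {x} {R} refl refl =
  val-at X , val-++ˡ X (x ∷ R) (length X) ≤-refl , val-after X

lastᵉ-++-∷ : ∀ X {y ys} → lastᵉ (X ++ y ∷ ys) ≡ lastᵉ (y ∷ ys)
lastᵉ-++-∷ []           = refl
lastᵉ-++-∷ (x ∷ [])     = refl
lastᵉ-++-∷ (x ∷ x′ ∷ X) = lastᵉ-++-∷ (x′ ∷ X)

lastᵉ-++ : ∀ {Q : Maybe ℕ → Set} X Y → Q (lastᵉ X) → Q (lastᵉ Y) → Q (lastᵉ (X ++ Y))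
lastᵉ-++ {Q} X []       qX _  = subst Q (cong lastᵉ (sym (++-identityʳ X))) qX
lastᵉ-++ {Q} X (y ∷ ys) _  qY = subst Q (sym (lastᵉ-++-∷ X)) qY

headᵉ-++ : ∀ {Q : Maybe ℕ → Set} X Y → Q (headᵉ X) → Q (headᵉ Y) → Q (headᵉ (X ++ Y))
headᵉ-++ []      Y _  qY = qY
headᵉ-++ (x ∷ X) Y qX _  = qX

lastᵉ-All : ∀ {P : ℕ → Set} x xs → All P (x ∷ xs) → ∃ λ y → lastᵉ (x ∷ xs) ≡ just y × P y
lastᵉ-All x []        (px ∷ _)   = x , refl , px
lastᵉ-All x (x′ ∷ xs) (_  ∷ pxs) = lastᵉ-All x′ xs pxs

length-∷ʳ : ∀ X {x : ℕ} → length (X ∷ʳ x) ≡ suc (length X)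
length-∷ʳ []      = refl
length-∷ʳ (_ ∷ X) = cong suc (length-∷ʳ X)

length-≤-++ : ∀ (X Y : List ℕ) → length X ≤ length (X ++ Y)
length-≤-++ []      Y = z≤n
length-≤-++ (x ∷ X) Y = s≤s (length-≤-++ X Y)

interleave : ∀ {m} → ℕ → Vec (List ℕ) (suc m) → List ℕ
interleave i (B ∷ [])      = B
interleave i (B ∷ B′ ∷ Bs) = B ++ i ∷ interleave i (B′ ∷ Bs)

nonEmpty : List ℕ → Bool
nonEmpty []      = false
nonEmpty (_ ∷ _) = true

positions : ∀ {m} → ℕ → List ℕ → Vec (List ℕ) (suc m) → Vec ℕ m
positions i Y (B ∷ [])      = []
positions i Y (B ∷ B′ ∷ Bs) = suc (length (Y ++ B)) ∷ positions i ((Y ++ B) ∷ʳ i) (B′ ∷ Bs)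

prefix-grows : ∀ i (Y B : List ℕ) → length Y < length ((Y ++ B) ∷ʳ i)
prefix-grows i Y B = <-≤-trans (s≤s (length-≤-++ Y B)) (≤-reflexive (sym (length-∷ʳ (Y ++ B))))

positions-beyond : ∀ {m} i Y (Bs : Vec (List ℕ) (suc m)) h → length Y < lookup (positions i Y Bs) h
positions-beyond i Y (B ∷ B′ ∷ Bs) fzero     = s≤s (length-≤-++ Y B)
positions-beyond i Y (B ∷ B′ ∷ Bs) (fsuc h) =
  <-trans (prefix-grows i Y B) (positions-beyond i ((Y ++ B) ∷ʳ i) (B′ ∷ Bs) h)

positions-increasing : ∀ {m} i Y (Bs : Vec (List ℕ) (suc m)) h h′ → toℕ h < toℕ h′ →
  lookup (positions i Y Bs) h < lookup (positions i Y Bs) h′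
positions-increasing i Y (B ∷ B′ ∷ Bs) fzero    (fsuc h′) _ =
  subst (_< lookup (positions i ((Y ++ B) ∷ʳ i) (B′ ∷ Bs)) h′) (length-∷ʳ (Y ++ B))
    (positions-beyond i ((Y ++ B) ∷ʳ i) (B′ ∷ Bs) h′)
positions-increasing i Y (B ∷ B′ ∷ Bs) (fsuc h) (fsuc h′) (s≤s h<h′) =
  positions-increasing i ((Y ++ B) ∷ʳ i) (B′ ∷ Bs) h h′ h<h′

record Occurrence {m} (i : ℕ) (Y : List ℕ) (Bs : Vec (List ℕ) (suc m)) (S : List ℕ) (h : Fin m) : Set where
  field
    before after : List ℕ
    split    : Y ++ interleave i Bs ++ S ≡ (before ++ lookup Bs (inject₁ h)) ++ i ∷ after
    position : lookup (positions i Y Bs) h ≡ suc (length (before ++ lookup Bs (inject₁ h)))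
    first    : toℕ h ≡ 0 → lastᵉ before ≡ lastᵉ Y
    later    : toℕ h ≢ 0 → lastᵉ before ≡ just i
    final    : suc (toℕ h) ≡ m → after ≡ lookup Bs (fsuc h) ++ S

split-after : ∀ (Y B : List ℕ) i I S → Y ++ (B ++ i ∷ I) ++ S ≡ (Y ++ B) ++ i ∷ I ++ S
split-after Y B i I S = trans (cong (Y ++_) (++-assoc B (i ∷ I) S)) (sym (++-assoc Y B _))

occurrence : ∀ {m} i Y (Bs : Vec (List ℕ) (suc m)) S (h : Fin m) → Occurrence i Y Bs S h
occurrence i Y (B ∷ B′ ∷ Bs) S fzero = record
  { before   = Y
  ; after    = interleave i (B′ ∷ Bs) ++ S
  ; split    = split-after Y B i _ S
  ; position = refl
  ; first    = λ _ → refl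
  ; later    = λ 0≢0 → ⊥-elim (0≢0 refl)
  ; final    = single-block {Bs = Bs}
  }
  where
  single-block : ∀ {n} {Bs : Vec (List ℕ) n} → 1 ≡ suc n → interleave i (B′ ∷ Bs) ++ S ≡ B′ ++ S
  single-block {Bs = []} refl = refl
occurrence i Y (B ∷ B′ ∷ Bs) S (fsuc h) = record
  { before   = before
  ; after    = after
  ; split    = trans reassociate split
  ; position = position
  ; first    = λ ()
  ; later    = λ _ → previous h first later
  ; final    = final ∘ cong pred
  }
  where
  Y′ : List ℕ
  Y′ = (Y ++ B) ∷ʳ i
  open Occurrence (occurrence i Y′ (B′ ∷ Bs) S h)
  reassociate : Y ++ (B ++ i ∷ interleave i (B′ ∷ Bs)) ++ S ≡ Y′ ++ interleave i (B′ ∷ Bs) ++ S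
  reassociate = trans (split-after Y B i _ S) (sym (++-assoc (Y ++ B) (i ∷ []) _))
  previous : ∀ {n} (h : Fin n) → (toℕ h ≡ 0 → lastᵉ before ≡ lastᵉ Y′) →
             (toℕ h ≢ 0 → lastᵉ before ≡ just i) → lastᵉ before ≡ just i
  previous fzero    atFirst _       = trans (atFirst refl) (lastᵉ-++-∷ (Y ++ B))
  previous (fsuc h) _       atLater = atLater λ ()

positions-complete : ∀ {m} i Y (Bs : Vec (List ℕ) (suc m)) S →
  VAll.All (All (_≢ i)) Bs → All (_≢ i) S →
  ∀ n → val (interleave i Bs ++ S) (suc n) ≡ just i →
  ∃ λ h → lookup (positions i Y Bs) h ≡ suc (length Y + n)
positions-complete i Y (B ∷ []) S (avoidB VAll.∷ _) avoidS n e =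
  ⊥-elim (All.lookup (All.++⁺ avoidB avoidS) (val-∈ (B ++ S) (suc n) e) refl)
positions-complete i Y (B ∷ B′ ∷ Bs) S (avoidB VAll.∷ avoidBs) avoidS n e
  with val-++-split B _ (suc n) (subst (λ w → val w (suc n) ≡ just i) (++-assoc B _ S) e)
... | inj₁ i∈B = ⊥-elim (All.lookup avoidB i∈B refl)
... | inj₂ (zero , refl , _) = fzero , cong suc (begin
      length (Y ++ B)              ≡⟨ length-++ Y ⟩
      length Y + length B          ≡⟨ cong (length Y +_) (sym (+-identityʳ (length B))) ⟩
      length Y + (length B + 0)    ∎)
  where open ≡-Reasoning
... | inj₂ (suc m , refl , e′) with positions-complete i ((Y ++ B) ∷ʳ i) (B′ ∷ Bs) S avoidBs avoidS m e′
...   | h , at-h = fsuc h , trans at-h (cong suc (begin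
      length ((Y ++ B) ∷ʳ i) + m         ≡⟨ cong (_+ m) (length-∷ʳ (Y ++ B)) ⟩
      suc (length (Y ++ B) + m)          ≡⟨ cong (λ l → suc (l + m)) (length-++ Y) ⟩
      suc (length Y + length B + m)      ≡⟨ cong suc (+-assoc (length Y) (length B) m) ⟩
      suc (length Y + (length B + m))    ≡⟨ sym (+-suc (length Y) (length B + m)) ⟩
      length Y + suc (length B + m)      ≡⟨ cong (length Y +_) (sym (+-suc (length B) m)) ⟩
      length Y + (length B + suc m)      ∎))
  where open ≡-Reasoning

-- `Beside i d d₀ b`: d is the entry on one side of a block of entries above
-- i, and b records whether the block is non-empty; if it is empty, d is the
-- entry d₀ beyond the block, otherwise d is an entry above i.
Beside : ℕ → Maybe ℕ → Maybe ℕ → Bool → Set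
Beside i d d₀ b = (b ≡ false × d ≡ d₀) ⊎ (b ≡ true × ∃ λ y → d ≡ just y × i < y)

beside-last : ∀ {i} Z B → All (i <_) B → Beside i (lastᵉ (Z ++ B)) (lastᵉ Z) (nonEmpty B)
beside-last Z []       _     = inj₁ (refl , cong lastᵉ (++-identityʳ Z))
beside-last Z (b ∷ bs) above with lastᵉ-All b bs above
... | y , last≡y , i<y = inj₂ (refl , y , trans (lastᵉ-++-∷ Z) last≡y , i<y)

beside-head : ∀ {i} B S → All (i <_) B → Beside i (headᵉ (B ++ S)) (headᵉ S) (nonEmpty B)
beside-head []       S _           = inj₁ (refl , refl)
beside-head (b ∷ bs) S (i<b ∷ _)   = inj₂ (refl , b , refl , i<b)

leftCond : ∀ {σ j i d₀ b} → val σ j ≡ just i → Beside i (val σ (j ∸ 1)) d₀ b →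
  d₀ <ᵉ just i → LeftCond σ j b
leftCond at (inj₁ (b≡ , d≡)) d₀<i         = inj₁ (subst₂ _<ᵉ_ (sym d≡) (sym at) d₀<i , b≡)
leftCond at (inj₂ (b≡ , y , d≡ , i<y)) _  = inj₂ (subst₂ _<ᵉ_ (sym at) (sym d≡) (just<just i<y) , b≡)

rightCond : ∀ {σ j i d₀ b} → val σ j ≡ just i → Beside i (val σ (suc j)) d₀ b →
  d₀ <ᵉ just i → RightCond σ j b
rightCond at (inj₁ (b≡ , d≡)) d₀<i        = inj₁ (subst₂ _<ᵉ_ (sym d≡) (sym at) d₀<i , b≡)
rightCond at (inj₂ (b≡ , y , d≡ , i<y)) _ = inj₂ (subst₂ _<ᵉ_ (sym at) (sym d≡) (just<just i<y) , b≡)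

midCond : ∀ {σ j i b} → val σ j ≡ just i → Beside i (val σ (j ∸ 1)) (just i) b → MidCond σ j b
midCond at (inj₁ (b≡ , d≡))             = inj₁ (trans d≡ (sym at) , b≡)
midCond at (inj₂ (b≡ , y , d≡ , i<y))   =
  inj₂ ((λ same → <-irrefl (just-injective (trans (sym at) (trans (sym same) d≡))) i<y) , b≡)

LeftContext : ℕ → List ℕ → Set
LeftContext i P = lastᵉ P <ᵉ just i × All (_≢ i) P

RightContext : ℕ → List ℕ → Set
RightContext i S = headᵉ S <ᵉ just i × All (_≢ i) S

above⇒≢ : ∀ {i} {B : List ℕ} → All (i <_) B → All (_≢ i) B
above⇒≢ = All.map (≢-sym ∘ <⇒≢)

blockWord-localType : ∀ {k} i P (Bs : Vec (List ℕ) (suc k)) S →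
  LeftContext i P → RightContext i S → VAll.All (All (i <_)) Bs →
  LocalType k (P ++ interleave i Bs ++ S) i (Vec.map nonEmpty Bs)
blockWord-localType {k} i P Bs S (lastP<i , avoidP) (headS<i , avoidS) above =
  js , (at-positions , positions-increasing i P Bs , complete) , conditions
  where
  σ : List ℕ
  σ = P ++ interleave i Bs ++ S
  js : Vec ℕ k
  js = positions i P Bs

  module At (h : Fin k) where
    open Occurrence (occurrence i P Bs S h) public
    B : List ℕ
    B = lookup Bs (inject₁ h)
    facts : val σ (lookup js h) ≡ just i × val σ (lookup js h ∸ 1) ≡ lastᵉ (before ++ B) ×
            val σ (suc (lookup js h)) ≡ headᵉ after
    facts = neighbours split position
    is-i : val σ (lookup js h) ≡ just i
    is-i = proj₁ facts
    aboveB : All (i <_) B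
    aboveB = lookup⁺ above (inject₁ h)
    left : Beside i (val σ (lookup js h ∸ 1)) (lastᵉ before) (lookup (Vec.map nonEmpty Bs) (inject₁ h))
    left = subst₂ (λ d b → Beside i d (lastᵉ before) b)
             (sym (proj₁ (proj₂ facts))) (sym (Vec.lookup-map (inject₁ h) nonEmpty Bs))
             (beside-last before B aboveB)

  at-positions : ∀ h → val σ (lookup js h) ≡ just i
  at-positions = At.is-i

  complete : ∀ j → val σ j ≡ just i → ∃ λ h → lookup js h ≡ j
  complete j e with val-++-split P _ j e
  ... | inj₁ i∈P             = ⊥-elim (All.lookup avoidP i∈P refl)
  ... | inj₂ (n , refl , e′) =
    positions-complete i P Bs S (VAll.map above⇒≢ above) avoidS n e′

  conditions : ∀ (h : Fin k) →
       (toℕ h ≡ 0 → LeftCond σ (lookup js h) (lookup (Vec.map nonEmpty Bs) (inject₁ h))) ×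
       (toℕ h ≢ 0 → MidCond σ (lookup js h) (lookup (Vec.map nonEmpty Bs) (inject₁ h))) ×
       (suc (toℕ h) ≡ k → RightCond σ (lookup js h) (lookup (Vec.map nonEmpty Bs) (fsuc h)))
  conditions h =
      (λ h≡0 → leftCond {σ} {lookup js h} is-i left (subst (_<ᵉ just i) (sym (first h≡0)) lastP<i))
    , (λ h≢0 → midCond {σ} {lookup js h} is-i (subst (λ d → Beside i (val σ (lookup js h ∸ 1)) d _) (later h≢0) left))
    , (λ last → rightCond {σ} {lookup js h} is-i (right last) headS<i)
    where
    open At h
    B′ : List ℕ
    B′ = lookup Bs (fsuc h)
    right : suc (toℕ h) ≡ k →
      Beside i (val σ (suc (lookup js h))) (headᵉ S) (lookup (Vec.map nonEmpty Bs) (fsuc h))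
    right last = subst₂ (λ d b → Beside i d (headᵉ S) b)
      (sym (trans (proj₂ (proj₂ facts)) (cong headᵉ (final last))))
      (sym (Vec.lookup-map (fsuc h) nonEmpty Bs))
      (beside-head B′ S (lookup⁺ above (fsuc h)))

Embedded : ℕ → List ℕ → List ℕ → Set
Embedded i W σ = ∃₂ λ P S → σ ≡ P ++ W ++ S × LeftContext i P × RightContext i S

embedded-refl : ∀ {i} W → Embedded i W W
embedded-refl W = [] , [] , sym (++-identityʳ W) , (-∞<just , []) , (-∞<just , [])

-- Contexts are closed under concatenation, so embeddings can be widened.
embed-left : ∀ {i W σ} L → LeftContext i L → Embedded i W σ → Embedded i W (L ++ σ)
embed-left {i} L (lastL , avoidL) (P , S , refl , (lastP , avoidP) , right) =
  L ++ P , S , sym (++-assoc L P _) ,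
  (lastᵉ-++ {_<ᵉ just i} L P lastL lastP , All.++⁺ avoidL avoidP) , right

embed-right : ∀ {i W σ} → Embedded i W σ → ∀ R → RightContext i R → Embedded i W (σ ++ R)
embed-right {i} {W} (P , S , refl , left , (headS , avoidS)) R (headR , avoidR) =
  P , S ++ R , trans (++-assoc P _ R) (cong (P ++_) (++-assoc W S R)) , left ,
  (headᵉ-++ {_<ᵉ just i} S R headS headR , All.++⁺ avoidS avoidR)

data Focus {A : Set} (P Q : A → Set) : ∀ {m} → Vec A m → Set where
  this : ∀ {m x} {xs : Vec A m} → P x → VAll.All Q xs → Focus P Q (x ∷ xs)
  skip : ∀ {m x} {xs : Vec A m} → Q x → Focus P Q xs → Focus P Q (x ∷ xs)

interleave-All : ∀ {Q : ℕ → Set} {m} v (Bs : Vec (List ℕ) (suc m)) →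
  Q v → VAll.All (All Q) Bs → All Q (interleave v Bs)
interleave-All v (B ∷ [])      qv (qB VAll.∷ VAll.[]) = qB
interleave-All v (B ∷ B′ ∷ Bs) qv (qB VAll.∷ qBs)     =
  All.++⁺ qB (qv ∷ interleave-All v (B′ ∷ Bs) qv qBs)

-- If one block of a block word for v < i embeds W and the other blocks
-- avoid i, the whole block word embeds W: the separators v are below i.
interleave-embedded : ∀ {m i v W} (Bs : Vec (List ℕ) (suc m)) → v < i →
  Focus (Embedded i W) (All (_≢ i)) Bs → Embedded i W (interleave v Bs)
interleave-embedded (B ∷ [])      v<i (this e VAll.[]) = e
interleave-embedded {v = v} (B ∷ B′ ∷ Bs) v<i (this e avoid) =
  embed-right e (v ∷ interleave v (B′ ∷ Bs))
    (just<just v<i , <⇒≢ v<i ∷ interleave-All v (B′ ∷ Bs) (<⇒≢ v<i) avoid)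
interleave-embedded {i = i} {v} {W} (B ∷ B′ ∷ Bs) v<i (skip avoidB focus) =
  subst (Embedded i W) (++-assoc B (v ∷ []) _)
    (embed-left (B ∷ʳ v)
      (subst (_<ᵉ just i) (sym (lastᵉ-++-∷ B)) (just<just v<i) , All.++⁺ avoidB (<⇒≢ v<i ∷ []))
      (interleave-embedded (B′ ∷ Bs) v<i focus))

codeRest-interleave : ∀ {k m} v c (cs : Vec (Tree k) m) →
  code c ++ codeRest v cs ≡ interleave v (code c ∷ Vec.map code cs)
codeRest-interleave v c []        = ++-identityʳ (code c)
codeRest-interleave v c (c′ ∷ cs) = cong (λ w → code c ++ v ∷ w) (codeRest-interleave v c′ cs)

code-interleave : ∀ {k} v (cs : Vec (Tree k) (suc k)) → code (node v cs) ≡ interleave v (Vec.map code cs)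
code-interleave v (c ∷ cs) = codeRest-interleave v c cs

mutual
  code-All : ∀ {k} {Q : ℕ → Set} (T : Tree k) → All Q (labels T) → All Q (code T)
  code-All ext         _        = []
  code-All (node v cs) (qv ∷ q) =
    subst (All _) (sym (code-interleave v cs)) (interleave-All v (Vec.map code cs) qv (codes-All cs q))

  codes-All : ∀ {k m} {Q : ℕ → Set} (cs : Vec (Tree k) m) →
    All Q (labelsVec cs) → VAll.All (All Q) (Vec.map code cs)
  codes-All []       _ = VAll.[]
  codes-All (c ∷ cs) q = code-All c (All.++⁻ˡ (labels c) q) VAll.∷ codes-All cs (All.++⁻ʳ (labels c) q)

mutual
  labels-above : ∀ {k v} {T : Tree k} → Increasing T → Above v T → All (v <_) (labels T)
  labels-above ext              _   = []
  labels-above (node incs abvs) v<w = v<w ∷ All.map (<-trans v<w) (labelsVec-above incs abvs)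

  labelsVec-above : ∀ {k m w} {cs : Vec (Tree k) m} →
    VAll.All Increasing cs → VAll.All (Above w) cs → All (w <_) (labelsVec cs)
  labelsVec-above VAll.[]         VAll.[]         = []
  labelsVec-above (ic VAll.∷ ics) (ac VAll.∷ acs) = All.++⁺ (labels-above ic ac) (labelsVec-above ics acs)

mutual
  hasNode-∈ : ∀ {k i ds} {T : Tree k} → HasNode T i ds → i ∈ labels T
  hasNode-∈ here       = here refl
  hasNode-∈ (there an) = there (anyNode-∈ an)

  anyNode-∈ : ∀ {k m i ds} {cs : Vec (Tree k) m} → VAny.Any (λ c → HasNode c i ds) cs → i ∈ labelsVec cs
  anyNode-∈ (here h)               = ∈-++⁺ˡ (hasNode-∈ h)
  anyNode-∈ {cs = c ∷ _} (there a) = ∈-++⁺ʳ (labels c) (anyNode-∈ a)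

mutual
  hasNode-increasing : ∀ {k i ds} {T : Tree k} → Increasing T → HasNode T i ds → Increasing (node i ds)
  hasNode-increasing inc              here       = inc
  hasNode-increasing (node incs _)    (there an) = anyNode-increasing incs an

  anyNode-increasing : ∀ {k m i ds} {cs : Vec (Tree k) m} → VAll.All Increasing cs →
    VAny.Any (λ c → HasNode c i ds) cs → Increasing (node i ds)
  anyNode-increasing (ic VAll.∷ _) (here h)  = hasNode-increasing ic h
  anyNode-increasing (_ VAll.∷ is) (there a) = anyNode-increasing is a

unique-++⁻ : ∀ (xs : List ℕ) {ys} → Unique (xs ++ ys) → Unique xs × Unique ys × Disjoint xs ys
unique-++⁻ []       u        = [] , u , λ { (() , _) }
unique-++⁻ (x ∷ xs) (x∉ ∷ u) with unique-++⁻ xs u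
... | uxs , uys , disj = All.++⁻ˡ xs x∉ ∷ uxs , uys , disj′
  where
  disj′ : Disjoint (x ∷ xs) _
  disj′ (here refl  , v∈ys) = All.lookup (All.++⁻ʳ xs x∉) v∈ys refl
  disj′ (there v∈xs , v∈ys) = disj (v∈xs , v∈ys)

disjoint-avoid : ∀ {xs ys : List ℕ} {x} → Disjoint xs ys → x ∈ xs → All (_≢ x) ys
disjoint-avoid disj x∈xs = All.tabulate λ y∈ys y≡x → disj (x∈xs , subst (_∈ _) y≡x y∈ys)

labels-unique : ∀ {k n} {T : Tree k} → labels T ↭ map suc (upTo n) → Unique (labels T)
labels-unique {n = n} perm =
  AllPairs-resp-↭ (setoid ℕ) ≢-sym (≉-resp₂ (setoid ℕ)) (↭⇒↭ₛ (↭-sym perm))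
    (Unique.map⁺ suc-injective (Unique.upTo⁺ n))

mutual
  embedded : ∀ {k i ds} {T : Tree k} → Increasing T → Unique (labels T) → HasNode T i ds →
    Embedded i (code (node i ds)) (code T)
  embedded {T = T} _ _ here = embedded-refl (code T)
  embedded {T = node v cs} (node incs abvs) (_ ∷ u) (there an) =
    subst (Embedded _ _) (sym (code-interleave v cs))
      (interleave-embedded (Vec.map code cs)
        (All.lookup (labelsVec-above incs abvs) (anyNode-∈ an)) (focus incs u an))

  focus : ∀ {k m i ds} {cs : Vec (Tree k) m} → VAll.All Increasing cs → Unique (labelsVec cs) →
    VAny.Any (λ c → HasNode c i ds) cs →
    Focus (Embedded i (code (node i ds))) (All (_≢ i)) (Vec.map code cs)
  focus {cs = c ∷ cs} (ic VAll.∷ _) u (here h) with unique-++⁻ (labels c) u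
  ... | uc , _ , disj = this (embedded ic uc h) (codes-All cs (disjoint-avoid disj (hasNode-∈ h)))
  focus {cs = c ∷ cs} (_ VAll.∷ is) u (there a) with unique-++⁻ (labels c) u
  ... | _ , ucs , disj =
    skip (code-All c (disjoint-avoid (DisjointProps.sym disj) (anyNode-∈ a))) (focus is ucs a)

occupied-code : ∀ {k} (c : Tree (suc k)) → occupied c ≡ nonEmpty (code c)
occupied-code ext                    = refl
occupied-code (node w (d ∷ d′ ∷ ds)) = sym (nonEmpty-∷ (code d))
  where
  nonEmpty-∷ : ∀ X {y Y} → nonEmpty (X ++ y ∷ Y) ≡ true
  nonEmpty-∷ []      = refl
  nonEmpty-∷ (_ ∷ _) = refl

nodeType-codes : ∀ {k} (cs : Vec (Tree (suc k)) (suc (suc k))) →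
  nodeTypeOf cs ≡ Vec.map nonEmpty (Vec.map code cs)
nodeType-codes cs = trans (Vec.map-cong occupied-code cs) (Vec.map-∘ nonEmpty code cs)

theorem3 : (k n : ℕ) → 1 ≤ k → 1 ≤ n →
    (T : Tree k) → IsIncreasingTree k n T →
    (i : ℕ) → 1 ≤ i → i ≤ n →
    (cs : Vec (Tree k) (suc k)) → HasNode T i cs →
    LocalType k (code T) i (nodeTypeOf cs)
theorem3 zero    _ () _ _ _ _ _ _ _ _
theorem3 (suc k) n _ _ T (increasing , perm) i _ _ cs hasNode
  with embedded increasing (labels-unique perm) hasNode | hasNode-increasing increasing hasNode
... | P , S , code≡ , left , right | node incs abvs =
  subst₂ (λ σ ℓ → LocalType (suc k) σ i ℓ) (sym code≡′) (sym (nodeType-codes cs))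
    (blockWord-localType i P (Vec.map code cs) S left right (codes-All cs (labelsVec-above incs abvs)))
  where
  code≡′ : code T ≡ P ++ interleave i (Vec.map code cs) ++ S
  code≡′ = trans code≡ (cong (λ W → P ++ W ++ S) (code-interleave i cs))
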